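{- Let $(T_1,r_1)$ and $(T_2,r_2)$ be rooted trees with $V(T_1)\cap V(T_2)=\emptyset$, let $(T,r_1)=(T_1,r_1)\circ(T_2,r_2)$, let $f:V(T)\to\{0,1,2\}$, and let $f_1=f|_{V(T_1)}$, $f_2=f|_{V(T_2)}$. Then $(T,f,r_1)\in E$ if and only if $(T_1,f_1,r_1)\in E$ and $(T_2,f_2,r_2)\in C$.
   Context: For a graph (or forest) $G$, an independent Roman $\{2\}$-dominating function (IR2DF) is a function $f:V(G)\to\{0,1,2\}$ such that every vertex $v$ with $f(v)=0$ satisfies $\sum_{u\in N(v)}f(u)\ge 2$ and the set $\{v: f(v)>0\}$ is independent; the empty function on the empty graph is regarded as an IR2DF. A rooted tree is a pair $(T,r)$ with $T$ a tree and $r\in V(T)$. For rooted trees with disjoint vertex sets, the composition $(T_1,r_1)\circ(T_2,r_2)=(T,r_1)$ has $V(T)=V(T_1)\cup V(T_2)$ and $E(T)=E(T_1)\cup E(T_2)\cup\{r_1r_2\}$. For a rooted tree $(T,r)$ and $f:V(T)\to\{0,1,2\}$, let $IR2DF(T)$ be the set of IR2DFs of $T$, $IR2DF_r(T)=\{f: f\notin IR2DF(T)$ and $f|_{V(T)\setminus\{r\}}\in IR2DF(T-r)\}$, and $f(N[r])=\sum_{u\in N_T[r]}f(u)$. Define the classes of triples: $C=\{(T,f,r): f\in IR2DF(T), f(r)=0\}$ and $E=\{(T,f,r): f\in IR2DF_r(T), f(N[r])=0\}$. -}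

module Defs where

open import Data.Nat using (ℕ; zero; suc; _+_; _≤_; _<ᵇ_)
open import Data.Fin using (Fin; toℕ; _↑ˡ_; _↑ʳ_; splitAt; _≟_)
import Data.Fin as Fin
open import Data.Bool using (Bool; true; false; if_then_else_; _∧_; not)
open import Data.Sum using (_⊎_; inj₁; inj₂)
open import Data.Product using (_×_)
open import Relation.Nullary using (¬_)
open import Relation.Nullary.Decidable using (⌊_⌋)
open import Relation.Binary.PropositionalEquality using (_≡_)
open import Relation.Binary.Construct.Closure.ReflexiveTransitive using (Star)

-- A (loopless, undirected) graph on the vertex set Fin n, given by its
-- Boolean adjacency relation.
Graph : ℕ → Set
Graph n = Fin n → Fin n → Bool

sumFin : (n : ℕ) → (Fin n → ℕ) → ℕ
sumFin zero    g = 0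
sumFin (suc n) g = g Fin.zero + sumFin n (λ i → g (Fin.suc i))

edgeCount : {n : ℕ} → Graph n → ℕ
edgeCount {n} G =
  sumFin n (λ i → sumFin n (λ j → if G i j ∧ (toℕ i <ᵇ toℕ j) then 1 else 0))

record IsTree {n : ℕ} (G : Graph n) : Set where
  field
    symmetric   : ∀ i j → G i j ≡ G j i
    irreflexive : ∀ i → G i i ≡ false
    connected   : ∀ i j → Star (λ a b → G a b ≡ true) i j
    edges       : edgeCount G + 1 ≡ n

-- f is an IR2DF of the induced subgraph G[S], S given as a Boolean predicate.
-- (f is a function V(G) → {0,1,2}; only its restriction to S matters.)
IsIR2DFOn : {n : ℕ} → Graph n → (Fin n → Bool) → (Fin n → Fin 3) → Set
IsIR2DFOn {n} G S f =
  (∀ v → S v ≡ true → toℕ (f v) ≡ 0 →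
     2 ≤ sumFin n (λ u → if S u ∧ G v u then toℕ (f u) else 0))
  ×
  (∀ u v → S u ≡ true → S v ≡ true → G u v ≡ true →
     (toℕ (f u) ≡ 0) ⊎ (toℕ (f v) ≡ 0))

IsIR2DF : {n : ℕ} → Graph n → (Fin n → Fin 3) → Set
IsIR2DF G f = IsIR2DFOn G (λ _ → true) f

IsIR2DF-r : {n : ℕ} → Graph n → (Fin n → Fin 3) → Fin n → Set
IsIR2DF-r G f r = ¬ IsIR2DF G f × IsIR2DFOn G (λ v → not ⌊ v ≟ r ⌋) f

fN : {n : ℕ} → Graph n → (Fin n → Fin 3) → Fin n → ℕ
fN {n} G f r = toℕ (f r) + sumFin n (λ u → if G r u then toℕ (f u) else 0)

InC : {n : ℕ} → Graph n → (Fin n → Fin 3) → Fin n → Set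
InC G f r = IsIR2DF G f × toℕ (f r) ≡ 0

InE : {n : ℕ} → Graph n → (Fin n → Fin 3) → Fin n → Set
InE G f r = IsIR2DF-r G f r × fN G f r ≡ 0

-- Composition (T1,r1) ∘ (T2,r2): vertex set Fin (n1 + n2), the disjoint
-- union (T1's vertices via _↑ˡ n2, T2's via n1 ↑ʳ_), plus the edge r1 r2.
-- The root of the composition is r1 ↑ˡ n2.
compose : {n1 n2 : ℕ} → Graph n1 → Fin n1 → Graph n2 → Fin n2 → Graph (n1 + n2)
compose {n1} {n2} G1 r1 G2 r2 i j with splitAt n1 i | splitAt n1 j
... | inj₁ x | inj₁ y = G1 x y
... | inj₂ x | inj₂ y = G2 x y
... | inj₁ x | inj₂ y = ⌊ x ≟ r1 ⌋ ∧ ⌊ y ≟ r2 ⌋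
... | inj₂ x | inj₁ y = ⌊ y ≟ r1 ⌋ ∧ ⌊ x ≟ r2 ⌋

{-# OPTIONS --safe #-}
-- Since f(N[r]) = 0 forces f(r) = 0 with no weight around r, the condition
-- f ∉ IR2DF(T) in E is automatic, so (T,f,r) ∈ E just says that f is an IR2DF
-- of T − r with f(N[r]) = 0.  In the composition, T − r₁ is the disjoint union
-- of T₁ − r₁ and T₂ (the only new edge r₁r₂ is gone), and an IR2DF of a
-- disjoint union is an IR2DF of each part; moreover f(N_T[r₁]) splits as
-- f₁(N_{T₁}[r₁]) + f(r₂).
module Submission where

open import Defs
open import Data.Nat using (ℕ; zero; suc; _+_; _≤_)
open import Data.Nat.Properties using (+-identityʳ; +-assoc; m+n≡0⇒m≡0; m+n≡0⇒n≡0)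
open import Data.Fin using (Fin; _↑ˡ_; _↑ʳ_; toℕ; _≟_; splitAt; join)
import Data.Fin as Fin
open import Data.Fin.Properties using (splitAt-↑ˡ; splitAt-↑ʳ; join-splitAt; ↑ˡ-injective)
open import Data.Product using (_×_; _,_; proj₁; proj₂)
open import Data.Sum using ([_,_])
open import Data.Bool using (Bool; true; false; not; _∧_; if_then_else_)
open import Relation.Nullary using (¬_; Dec; yes; no)
open import Relation.Nullary.Decidable
  using (⌊_⌋; isYes≗does; ⌊⌋-map′; dec-true; dec-false)
open import Relation.Binary.PropositionalEquality
  using (_≡_; _≢_; refl; sym; trans; cong; cong₂; subst; module ≡-Reasoning)
open import Function using (_∘_)
open import Function.Bundles using (_⇔_; mk⇔; Equivalence)
open import Function.Properties.Equivalence using () renaming (trans to ⇔-trans)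
open import Data.Product.Function.NonDependent.Propositional using (_×-⇔_)

private
  variable
    n n1 n2 : ℕ

sumFin-cong : ∀ n {g h : Fin n → ℕ} → (∀ i → g i ≡ h i) → sumFin n g ≡ sumFin n h
sumFin-cong zero    eq = refl
sumFin-cong (suc n) eq = cong₂ _+_ (eq Fin.zero) (sumFin-cong n (eq ∘ Fin.suc))

sumFin-zero : ∀ n {g : Fin n → ℕ} → (∀ i → g i ≡ 0) → sumFin n g ≡ 0
sumFin-zero zero    eq = refl
sumFin-zero (suc n) eq = cong₂ _+_ (eq Fin.zero) (sumFin-zero n (eq ∘ Fin.suc))

sumFin-↑ : ∀ n1 n2 (g : Fin (n1 + n2) → ℕ) →
           sumFin (n1 + n2) g ≡ sumFin n1 (g ∘ (_↑ˡ n2)) + sumFin n2 (g ∘ (n1 ↑ʳ_))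
sumFin-↑ zero     n2 g = refl
sumFin-↑ (suc n1) n2 g = trans (cong (g Fin.zero +_) (sumFin-↑ n1 n2 (g ∘ Fin.suc)))
                               (sym (+-assoc (g Fin.zero) _ _))

sumFin-indicator : ∀ n (g : Fin n → ℕ) r →
                   sumFin n (λ u → if ⌊ u ≟ r ⌋ then g u else 0) ≡ g r
sumFin-indicator (suc n) g Fin.zero    =
  trans (cong (g Fin.zero +_) (sumFin-zero n λ _ → refl)) (+-identityʳ (g Fin.zero))
sumFin-indicator (suc n) g (Fin.suc r) =
  trans (sumFin-cong n λ u → cong (if_then g (Fin.suc u) else 0) (⌊⌋-map′ _ _ (u ≟ r)))
        (sumFin-indicator n (g ∘ Fin.suc) r)

⌊⌋-true : ∀ {A : Set} (a? : Dec A) → A → ⌊ a? ⌋ ≡ true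
⌊⌋-true a? a = trans (isYes≗does a?) (dec-true a? a)

⌊⌋-false : ∀ {A : Set} (a? : Dec A) → ¬ A → ⌊ a? ⌋ ≡ false
⌊⌋-false a? ¬a = trans (isYes≗does a?) (dec-false a? ¬a)

∧-false : ∀ {a b} → (a ≡ true → b ≡ false) → a ∧ b ≡ false
∧-false {false} _ = refl
∧-false {true}  h = h refl

↑-elim : (P : Fin (n1 + n2) → Set) →
         (∀ x → P (x ↑ˡ n2)) → (∀ y → P (n1 ↑ʳ y)) → ∀ w → P w
↑-elim {n1} {n2} P left right w =
  subst P (join-splitAt n1 n2 w) ([_,_] {C = P ∘ join n1 n2} left right (splitAt n1 w))

↑ʳ≢↑ˡ : (x : Fin n1) (y : Fin n2) → n1 ↑ʳ y ≢ x ↑ˡ n2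
↑ʳ≢↑ˡ {n1} {n2} x y eq with () ← trans (sym (splitAt-↑ʳ n1 n2 y))
                                         (trans (cong (splitAt n1) eq) (splitAt-↑ˡ n1 x n2))

weightOn : Graph n → (Fin n → Bool) → (Fin n → Fin 3) → Fin n → ℕ
weightOn {n} G S f v = sumFin n (λ u → if S u ∧ G v u then toℕ (f u) else 0)

Punctured : Fin n → Fin n → Bool
Punctured r v = not ⌊ v ≟ r ⌋

Punctured-≢ : ∀ {r v : Fin n} → Punctured r v ≡ true → v ≢ r
Punctured-≢ {r = r} {v} p v≡r with () ← trans (sym p) (cong not (⌊⌋-true (v ≟ r) v≡r))

fN≡0⇒¬IsIR2DF : ∀ (G : Graph n) f r → fN G f r ≡ 0 → ¬ IsIR2DF G f
fN≡0⇒¬IsIR2DF G f r fN≡0 (dominating , _)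
  with () ← subst (2 ≤_) (m+n≡0⇒n≡0 (toℕ (f r)) fN≡0)
                  (dominating r refl (m+n≡0⇒m≡0 (toℕ (f r)) fN≡0))

InE-intro : ∀ (G : Graph n) f r → IsIR2DFOn G (Punctured r) f → fN G f r ≡ 0 → InE G f r
InE-intro G f r ir2df fN≡0 = (fN≡0⇒¬IsIR2DF G f r fN≡0 , ir2df) , fN≡0

IsIR2DFOn-cong : ∀ {G H : Graph n} {S S′ : Fin n → Bool} {f} →
                 (∀ u v → G u v ≡ H u v) → (∀ v → S v ≡ S′ v) →
                 IsIR2DFOn G S f ⇔ IsIR2DFOn H S′ f
IsIR2DFOn-cong {n} {f = f} G≗H S≗S′ =
  mk⇔ (transport G≗H S≗S′) (transport (λ u v → sym (G≗H u v)) (λ v → sym (S≗S′ v)))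
  where
  transport : ∀ {G H : Graph n} {S S′} → (∀ u v → G u v ≡ H u v) → (∀ v → S v ≡ S′ v) →
              IsIR2DFOn G S f → IsIR2DFOn H S′ f
  transport {G} {H} {S} {S′} G≗H S≗S′ (dominating , independent) =
    (λ v Sv fv≡0 → subst (2 ≤_) (weight≡ v) (dominating v (trans (S≗S′ v) Sv) fv≡0)) ,
    (λ u v Su Sv Guv → independent u v (trans (S≗S′ u) Su) (trans (S≗S′ v) Sv)
                                       (trans (G≗H u v) Guv))
    where
    weight≡ : ∀ v → weightOn G S f v ≡ weightOn H S′ f v
    weight≡ v = sumFin-cong n λ u →
      cong (if_then toℕ (f u) else 0) (cong₂ _∧_ (S≗S′ u) (G≗H v u))

module DisjointUnion {n1 n2 : ℕ} (G : Graph (n1 + n2)) (S : Fin (n1 + n2) → Bool) where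

  left : Graph n1
  left x y = G (x ↑ˡ n2) (y ↑ˡ n2)

  right : Graph n2
  right x y = G (n1 ↑ʳ x) (n1 ↑ʳ y)

  NoCrossEdges : Set
  NoCrossEdges = ∀ x y → S (x ↑ˡ n2) ≡ true → S (n1 ↑ʳ y) ≡ true →
                 G (x ↑ˡ n2) (n1 ↑ʳ y) ≡ false × G (n1 ↑ʳ y) (x ↑ˡ n2) ≡ false

  module _ (noCross : NoCrossEdges) (f : Fin (n1 + n2) → Fin 3) where

    Left Right : Set
    Left  = IsIR2DFOn left (S ∘ (_↑ˡ n2)) (f ∘ (_↑ˡ n2))
    Right = IsIR2DFOn right (S ∘ (n1 ↑ʳ_)) (f ∘ (n1 ↑ʳ_))

    weightOn-↑ˡ : ∀ x → S (x ↑ˡ n2) ≡ true →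
                  weightOn G S f (x ↑ˡ n2)
                    ≡ weightOn left (S ∘ (_↑ˡ n2)) (f ∘ (_↑ˡ n2)) x
    weightOn-↑ˡ x Sx =
      trans (sumFin-↑ n1 n2 (λ u → if S u ∧ G (x ↑ˡ n2) u then toℕ (f u) else 0))
            (trans (cong (weightOn left (S ∘ (_↑ˡ n2)) (f ∘ (_↑ˡ n2)) x +_) crossWeight)
                   (+-identityʳ _))
      where
      crossWeight : sumFin n2 (λ y → if S (n1 ↑ʳ y) ∧ G (x ↑ˡ n2) (n1 ↑ʳ y)
                                     then toℕ (f (n1 ↑ʳ y)) else 0) ≡ 0
      crossWeight = sumFin-zero n2 λ y →
        cong (if_then toℕ (f (n1 ↑ʳ y)) else 0) (∧-false λ Sy → proj₁ (noCross x y Sx Sy))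

    weightOn-↑ʳ : ∀ y → S (n1 ↑ʳ y) ≡ true →
                  weightOn G S f (n1 ↑ʳ y)
                    ≡ weightOn right (S ∘ (n1 ↑ʳ_)) (f ∘ (n1 ↑ʳ_)) y
    weightOn-↑ʳ y Sy =
      trans (sumFin-↑ n1 n2 (λ u → if S u ∧ G (n1 ↑ʳ y) u then toℕ (f u) else 0))
            (cong (_+ weightOn right (S ∘ (n1 ↑ʳ_)) (f ∘ (n1 ↑ʳ_)) y) crossWeight)
      where
      crossWeight : sumFin n1 (λ x → if S (x ↑ˡ n2) ∧ G (n1 ↑ʳ y) (x ↑ˡ n2)
                                     then toℕ (f (x ↑ˡ n2)) else 0) ≡ 0
      crossWeight = sumFin-zero n1 λ x →
        cong (if_then toℕ (f (x ↑ˡ n2)) else 0) (∧-false λ Sx → proj₂ (noCross x y Sx Sy))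

    IsIR2DFOn-⊎ : IsIR2DFOn G S f ⇔ (Left × Right)
    IsIR2DFOn-⊎ = mk⇔ restrict glue
      where
      restrict : IsIR2DFOn G S f → Left × Right
      restrict (dominating , independent) =
        ( (λ x Sx fx≡0 → subst (2 ≤_) (weightOn-↑ˡ x Sx) (dominating _ Sx fx≡0))
        , (λ x x′ → independent (x ↑ˡ n2) (x′ ↑ˡ n2)) )
        ,
        ( (λ y Sy fy≡0 → subst (2 ≤_) (weightOn-↑ʳ y Sy) (dominating _ Sy fy≡0))
        , (λ y y′ → independent (n1 ↑ʳ y) (n1 ↑ʳ y′)) )

      glue : Left × Right → IsIR2DFOn G S f
      glue ((dominatingˡ , independentˡ) , (dominatingʳ , independentʳ)) =
        ↑-elim _ (λ x Sx fx≡0 → subst (2 ≤_) (sym (weightOn-↑ˡ x Sx)) (dominatingˡ x Sx fx≡0))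
                 (λ y Sy fy≡0 → subst (2 ≤_) (sym (weightOn-↑ʳ y Sy)) (dominatingʳ y Sy fy≡0))
        ,
        ↑-elim _ (λ x → ↑-elim _ (independentˡ x)
                          (λ y Sx Sy Gxy → crossEdge (proj₁ (noCross x y Sx Sy)) Gxy))
                 (λ y → ↑-elim _ (λ x Sy Sx Gyx → crossEdge (proj₂ (noCross x y Sx Sy)) Gyx)
                          (independentʳ y))
        where
        crossEdge : ∀ {b} {A : Set} → b ≡ false → b ≡ true → A
        crossEdge refl ()

module Composition {n1 n2 : ℕ} (T1 : Graph n1) (r1 : Fin n1) (T2 : Graph n2) (r2 : Fin n2)
  where

  T : Graph (n1 + n2)
  T = compose T1 r1 T2 r2

  r : Fin (n1 + n2)
  r = r1 ↑ˡ n2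

  compose-↑ˡ-↑ˡ : ∀ x y → T (x ↑ˡ n2) (y ↑ˡ n2) ≡ T1 x y
  compose-↑ˡ-↑ˡ x y rewrite splitAt-↑ˡ n1 x n2 | splitAt-↑ˡ n1 y n2 = refl

  compose-↑ʳ-↑ʳ : ∀ x y → T (n1 ↑ʳ x) (n1 ↑ʳ y) ≡ T2 x y
  compose-↑ʳ-↑ʳ x y rewrite splitAt-↑ʳ n1 n2 x | splitAt-↑ʳ n1 n2 y = refl

  compose-↑ˡ-↑ʳ : ∀ x y → T (x ↑ˡ n2) (n1 ↑ʳ y) ≡ ⌊ x ≟ r1 ⌋ ∧ ⌊ y ≟ r2 ⌋
  compose-↑ˡ-↑ʳ x y rewrite splitAt-↑ˡ n1 x n2 | splitAt-↑ʳ n1 n2 y = refl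

  compose-↑ʳ-↑ˡ : ∀ y x → T (n1 ↑ʳ y) (x ↑ˡ n2) ≡ ⌊ x ≟ r1 ⌋ ∧ ⌊ y ≟ r2 ⌋
  compose-↑ʳ-↑ˡ y x rewrite splitAt-↑ʳ n1 n2 y | splitAt-↑ˡ n1 x n2 = refl

  Punctured-↑ˡ : ∀ x → Punctured r (x ↑ˡ n2) ≡ Punctured r1 x
  Punctured-↑ˡ x with x ≟ r1
  ... | yes refl = cong not (⌊⌋-true ((x ↑ˡ n2) ≟ r) refl)
  ... | no x≢r1  = cong not (⌊⌋-false ((x ↑ˡ n2) ≟ r) (x≢r1 ∘ ↑ˡ-injective n2 x r1))

  Punctured-↑ʳ : ∀ y → Punctured r (n1 ↑ʳ y) ≡ true
  Punctured-↑ʳ y = cong not (⌊⌋-false ((n1 ↑ʳ y) ≟ r) (↑ʳ≢↑ˡ r1 y))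

  noCrossEdges : DisjointUnion.NoCrossEdges T (Punctured r)
  noCrossEdges x y rx _ = trans (compose-↑ˡ-↑ʳ x y) (cong (_∧ ⌊ y ≟ r2 ⌋) x≢r1)
                        , trans (compose-↑ʳ-↑ˡ y x) (cong (_∧ ⌊ y ≟ r2 ⌋) x≢r1)
    where
    x≢r1 : ⌊ x ≟ r1 ⌋ ≡ false
    x≢r1 = ⌊⌋-false (x ≟ r1) (Punctured-≢ (trans (sym (Punctured-↑ˡ x)) rx))

  module _ (f : Fin (n1 + n2) → Fin 3) where

    f1 : Fin n1 → Fin 3
    f1 = f ∘ (_↑ˡ n2)

    f2 : Fin n2 → Fin 3
    f2 = f ∘ (n1 ↑ʳ_)

    IsIR2DFOn-compose : IsIR2DFOn T (Punctured r) f
                          ⇔ (IsIR2DFOn T1 (Punctured r1) f1 × IsIR2DF T2 f2)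
    IsIR2DFOn-compose =
      ⇔-trans (DisjointUnion.IsIR2DFOn-⊎ T (Punctured r) noCrossEdges f)
              (IsIR2DFOn-cong compose-↑ˡ-↑ˡ Punctured-↑ˡ ×-⇔
               IsIR2DFOn-cong compose-↑ʳ-↑ʳ Punctured-↑ʳ)

    fN-compose : fN T f r ≡ fN T1 f1 r1 + toℕ (f2 r2)
    fN-compose = begin
      toℕ (f r) + sumFin (n1 + n2) (λ u → if T r u then toℕ (f u) else 0)
        ≡⟨ cong (toℕ (f r) +_) (sumFin-↑ n1 n2 (λ u → if T r u then toℕ (f u) else 0)) ⟩
      toℕ (f r) + (sumFin n1 (λ x → if T r (x ↑ˡ n2) then toℕ (f1 x) else 0) + weightʳ)
        ≡⟨ sym (+-assoc (toℕ (f r)) _ weightʳ) ⟩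
      toℕ (f r) + sumFin n1 (λ x → if T r (x ↑ˡ n2) then toℕ (f1 x) else 0) + weightʳ
        ≡⟨ cong₂ (λ s t → toℕ (f r) + s + t) (sumFin-cong n1 λ x →
                   cong (if_then toℕ (f1 x) else 0) (compose-↑ˡ-↑ˡ r1 x)) weightʳ≡f2r2 ⟩
      fN T1 f1 r1 + toℕ (f2 r2) ∎
      where
      open ≡-Reasoning
      weightʳ : ℕ
      weightʳ = sumFin n2 (λ y → if T r (n1 ↑ʳ y) then toℕ (f2 y) else 0)
      weightʳ≡f2r2 : weightʳ ≡ toℕ (f2 r2)
      weightʳ≡f2r2 = trans
        (sumFin-cong n2 λ y → cong (if_then toℕ (f2 y) else 0)
           (trans (compose-↑ˡ-↑ʳ r1 y) (cong (_∧ ⌊ y ≟ r2 ⌋) (⌊⌋-true (r1 ≟ r1) refl))))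
        (sumFin-indicator n2 (toℕ ∘ f2) r2)

lemma6 : (n1 n2 : ℕ) (T1 : Graph n1) (r1 : Fin n1) (T2 : Graph n2) (r2 : Fin n2) →
         IsTree T1 → IsTree T2 →
         (f : Fin (n1 + n2) → Fin 3) →
         InE (compose T1 r1 T2 r2) f (r1 ↑ˡ n2)
           ⇔ (InE T1 (f ∘ (_↑ˡ n2)) r1 × InC T2 (f ∘ (n1 ↑ʳ_)) r2)
lemma6 n1 n2 T1 r1 T2 r2 _ _ f = mk⇔ split combine
  where
  open Composition T1 r1 T2 r2

  split : InE T f r → InE T1 (f1 f) r1 × InC T2 (f2 f) r2
  split ((_ , ir2df) , fN≡0)
    with ir2dfˡ , ir2dfʳ ← Equivalence.to (IsIR2DFOn-compose f) ir2df =
    InE-intro T1 (f1 f) r1 ir2dfˡ (m+n≡0⇒m≡0 _ fN-parts≡0)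
    , (ir2dfʳ , m+n≡0⇒n≡0 _ fN-parts≡0)
    where
    fN-parts≡0 : fN T1 (f1 f) r1 + toℕ (f2 f r2) ≡ 0
    fN-parts≡0 = trans (sym (fN-compose f)) fN≡0

  combine : InE T1 (f1 f) r1 × InC T2 (f2 f) r2 → InE T f r
  combine (((_ , ir2dfˡ) , fN₁≡0) , (ir2dfʳ , f2r2≡0)) =
    InE-intro T f r (Equivalence.from (IsIR2DFOn-compose f) (ir2dfˡ , ir2dfʳ))
                    (trans (fN-compose f) (cong₂ _+_ fN₁≡0 f2r2≡0))
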